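{- Let an instance of the destructive weighted-\$-protection problem with scoring rule $\alpha$ be given, and form the corresponding instance of the minmax vector addition problem (same voters, weights, prices and budgets, with $\vec\Lambda=(\Lambda(c_1),\dots,\Lambda(c_{m-1}))$ the scores without bribery and $\vec\Delta_j$ as defined in the context). Then the answer to the destructive weighted-\$-protection instance is Yes if and only if the answer to the corresponding minmax vector addition instance is Yes.
   Context: An election has candidates $c_1,\dots,c_m$ and voters $v_1,\dots,v_n$; voter $v_j$ has a preference list $\tau_j$ (a permutation; $\tau_j^{ -1}(i)$ denotes the position of $c_i$ in $v_j$'s list), a weight $w_j\in\mathbb Z_{>0}$, an awarding price $p^a_j$ and a bribing price $p^b_j$. Scoring rule $\alpha$: nonnegative integers $\alpha_1\ge\dots\ge\alpha_m$; $v_j$ gives $w_j\alpha_{\tau_j^{ -1}(i)}$ points to $c_i$; $\Lambda(c_i)$ is the total score of $c_i$ without bribery, and $c_m$ is the winner without bribery. Destructive weighted-\$-protection: answer Yes iff there is $\mathcal V_F$ with $\sum_{v_j\in\mathcal V_F}p^a_j\le F$ such that for every $\mathcal V_B\subseteq\mathcal V\setminus\mathcal V_F$ with $\sum_{v_j\in\mathcal V_B}p^b_j\le B$ and every replacement of the preference lists of voters in $\mathcal V_B$ by arbitrary lists, no $c_i$ ($i<m$) gets a score strictly higher than $c_m$. Minmax vector addition: for each voter let $\vec\Delta_j=(\Delta_{1j},\dots,\Delta_{(m-1)j})$ with $\Delta_{ij}=\alpha_1-\alpha_{\tau_j^{ -1}(i)}+\alpha_{\tau_j^{ -1}(m)}-\alpha_m$;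 the answer is Yes iff there exists $\mathcal V_F\subseteq\mathcal V$ with $\sum_{v_j\in\mathcal V_F}p^a_j\le F$ such that for every $\mathcal V_B\subseteq\mathcal V\setminus\mathcal V_F$ with $\sum_{v_j\in\mathcal V_B}p^b_j\le B$ it holds that $\bigl\|\vec\Lambda+\sum_{v_j\in\mathcal V_B}w_j\vec\Delta_j\bigr\|_\infty\le\Lambda(c_m)$, where $\|\cdot\|_\infty$ is the maximum absolute value of the coordinates. -}

module Defs where

open import Data.Nat as ℕ using (ℕ; zero; suc; _⊔_)
open import Data.Integer as ℤ using (ℤ; +_; ∣_∣)
open import Data.Fin using (Fin; zero; suc; inject₁; fromℕ)
open import Data.Fin.Permutation using (Permutation′; _⟨$⟩ˡ_)
open import Data.Fin.Subset using (Subset; _∈_)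
open import Data.Fin.Subset.Properties using (_∈?_)
open import Data.Bool using (if_then_else_)
open import Relation.Nullary.Decidable using (does)

-- Candidates are Fin (suc k): c_1,…,c_m with m = suc k; c_i is Fin index i-1.
-- c_m (the non-bribery winner) is  fromℕ k ; c_i for i < m is  inject₁ i  (i : Fin k).
-- A preference list τ is a permutation τ : Fin m ↔ Fin m, read as
-- position ↦ candidate; τ⁻¹(c) = pos τ c is the position (0-based) of c.
pos : ∀ {m} → Permutation′ m → Fin m → Fin m
pos τ c = τ ⟨$⟩ˡ c

sumℕ : ∀ {n} → (Fin n → ℕ) → ℕ
sumℕ {zero}  f = 0
sumℕ {suc n} f = f zero ℕ.+ sumℕ (λ i → f (suc i))

sumℤ : ∀ {n} → (Fin n → ℤ) → ℤ
sumℤ {zero}  f = + 0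
sumℤ {suc n} f = f zero ℤ.+ sumℤ (λ i → f (suc i))

sumOverℕ : ∀ {n} → Subset n → (Fin n → ℕ) → ℕ
sumOverℕ S f = sumℕ (λ j → if does (j ∈? S) then f j else 0)

sumOverℤ : ∀ {n} → Subset n → (Fin n → ℤ) → ℤ
sumOverℤ S f = sumℤ (λ j → if does (j ∈? S) then f j else + 0)

‖_‖∞ : ∀ {k} → (Fin k → ℤ) → ℕ
‖_‖∞ {zero}  v = 0
‖_‖∞ {suc k} v = ∣ v zero ∣ ⊔ ‖ (λ i → v (suc i)) ‖∞

score : ∀ {m n} → (Fin m → ℕ) → (Fin n → ℕ) → (Fin n → Permutation′ m) → Fin m → ℕ
score α w τ c = sumℕ (λ j → w j ℕ.* α (pos (τ j) c))

bribed : ∀ {m n} → (Fin n → Permutation′ m) → Subset n → (Fin n → Permutation′ m)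
       → Fin n → Permutation′ m
bribed τ VB σ j = if does (j ∈? VB) then σ j else τ j

Λ : ∀ {m n} → (Fin m → ℕ) → (Fin n → ℕ) → (Fin n → Permutation′ m) → Fin m → ℕ
Λ = score

Δ : ∀ {k n} → (Fin (suc k) → ℕ) → (Fin n → Permutation′ (suc k)) → Fin k → Fin n → ℤ
Δ {k} α τ i j =
  ((+ α zero ℤ.- + α (pos (τ j) (inject₁ i))) ℤ.+ + α (pos (τ j) (fromℕ k))) ℤ.- + α (fromℕ k)

ProtectionYes : ∀ {k n} → (α : Fin (suc k) → ℕ) → (w : Fin n → ℕ)
  → (τ : Fin n → Permutation′ (suc k)) → (pa pb : Fin n → ℕ) → (F B : ℕ) → Set
ProtectionYes {k} {n} α w τ pa pb F B =
  Σ (Subset n) λ VF → sumOverℕ VF pa ℕ.≤ F ×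
    ((VB : Subset n) → VB ⊆ ∁ VF → sumOverℕ VB pb ℕ.≤ B →
     (σ : Fin n → Permutation′ (suc k)) → (i : Fin k) →
     score α w (bribed τ VB σ) (inject₁ i) ℕ.≤ score α w (bribed τ VB σ) (fromℕ k))
  where
  open import Data.Product using (Σ; _×_)
  open import Data.Fin.Subset using (_⊆_; ∁)

MinmaxYes : ∀ {k n} → (α : Fin (suc k) → ℕ) → (w : Fin n → ℕ)
  → (τ : Fin n → Permutation′ (suc k)) → (pa pb : Fin n → ℕ) → (F B : ℕ) → Set
MinmaxYes {k} {n} α w τ pa pb F B =
  Σ (Subset n) λ VF → sumOverℕ VF pa ℕ.≤ F ×
    ((VB : Subset n) → VB ⊆ ∁ VF → sumOverℕ VB pb ℕ.≤ B →
     ‖ (λ i → + Λ α w τ (inject₁ i) ℤ.+ sumOverℤ VB (λ j → + w j ℤ.* Δ α τ i j)) ‖∞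
       ℕ.≤ Λ α w τ (fromℕ k))
  where
  open import Data.Product using (Σ; _×_)
  open import Data.Fin.Subset using (_⊆_; ∁)

-- Fix the bribed set V_B and a candidate c_i.  A bribed voter j can change the
-- margin score(c_m) − score(c_i) by at most w_j Δ_ij, namely by ranking c_i first
-- and c_m last; unbribed voters keep their contribution.  Hence the worst margin
-- over all bribes is Λ(c_m) − (Λ(c_i) + Σ_{V_B} w_j Δ_ij), and c_m survives every
-- bribe of V_B iff every coordinate of the minmax vector is at most Λ(c_m).  Those
-- coordinates are nonnegative because α is nonincreasing, so this is exactly the
-- sup-norm condition.
module Submission where

open import Defs
open import Data.Nat as ℕ using (ℕ; zero; suc; _≤_; _<_; z≤n)
import Data.Nat.Properties as ℕ
open import Data.Fin as Fin using (Fin; inject₁; fromℕ)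
open import Data.Fin.Permutation using (Permutation′; transpose)
open import Data.Integer as ℤ using (ℤ; +_; ∣_∣; +≤+)
import Data.Integer.Properties as ℤ
open import Data.Integer.Tactic.RingSolver using (solve-∀)
import Data.Fin.Properties as Fin
open import Data.Fin.Subset using (Subset)
open import Data.Fin.Subset.Properties using (_∈?_)
open import Data.Bool using (true; false; if_then_else_)
open import Data.Empty using (⊥-elim)
open import Data.Product using (_×_; _,_)
open import Relation.Nullary.Decidable using (does; yes; no)
open import Relation.Binary.PropositionalEquality

sumℤ-cong : ∀ {n} {f g : Fin n → ℤ} → (∀ j → f j ≡ g j) → sumℤ f ≡ sumℤ g
sumℤ-cong {zero}  f≗g = refl
sumℤ-cong {suc n} f≗g = cong₂ ℤ._+_ (f≗g Fin.zero) (sumℤ-cong (λ j → f≗g (Fin.suc j)))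

sumℤ-mono-≤ : ∀ {n} {f g : Fin n → ℤ} → (∀ j → f j ℤ.≤ g j) → sumℤ f ℤ.≤ sumℤ g
sumℤ-mono-≤ {zero}  f≤g = ℤ.≤-refl
sumℤ-mono-≤ {suc n} f≤g = ℤ.+-mono-≤ (f≤g Fin.zero) (sumℤ-mono-≤ (λ j → f≤g (Fin.suc j)))

sumℤ-nonneg : ∀ {n} {f : Fin n → ℤ} → (∀ j → + 0 ℤ.≤ f j) → + 0 ℤ.≤ sumℤ f
sumℤ-nonneg {zero}  0≤f = ℤ.≤-refl
sumℤ-nonneg {suc n} 0≤f = ℤ.+-mono-≤ (0≤f Fin.zero) (sumℤ-nonneg (λ j → 0≤f (Fin.suc j)))

sumℤ-minus : ∀ {n} (f g : Fin n → ℤ) → sumℤ (λ j → f j ℤ.- g j) ≡ sumℤ f ℤ.- sumℤ g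
sumℤ-minus {zero}  f g = refl
sumℤ-minus {suc n} f g = begin
    (f Fin.zero ℤ.- g Fin.zero) ℤ.+ sumℤ (λ j → f (Fin.suc j) ℤ.- g (Fin.suc j))
  ≡⟨ cong (ℤ._+_ (f Fin.zero ℤ.- g Fin.zero)) (sumℤ-minus (λ j → f (Fin.suc j)) (λ j → g (Fin.suc j))) ⟩
    (f Fin.zero ℤ.- g Fin.zero) ℤ.+ (sumℤ (λ j → f (Fin.suc j)) ℤ.- sumℤ (λ j → g (Fin.suc j)))
  ≡⟨ interchange (f Fin.zero) (g Fin.zero) _ _ ⟩
    sumℤ f ℤ.- sumℤ g ∎
  where
  open ≡-Reasoning
  interchange : ∀ a b s t → (a ℤ.- b) ℤ.+ (s ℤ.- t) ≡ (a ℤ.+ s) ℤ.- (b ℤ.+ t)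
  interchange = solve-∀

pos-sumℕ : ∀ {n} (f : Fin n → ℕ) → + sumℕ f ≡ sumℤ (λ j → + f j)
pos-sumℕ {zero}  f = refl
pos-sumℕ {suc n} f = trans (ℤ.pos-+ (f Fin.zero) (sumℕ (λ j → f (Fin.suc j))))
                           (cong (ℤ._+_ (+ f Fin.zero)) (pos-sumℕ (λ j → f (Fin.suc j))))

‖‖∞-lub : ∀ {k} {v : Fin k → ℤ} {N} → (∀ i → ∣ v i ∣ ≤ N) → ‖ v ‖∞ ≤ N
‖‖∞-lub {zero}  ∣v∣≤N = z≤n
‖‖∞-lub {suc k} ∣v∣≤N = ℕ.⊔-lub (∣v∣≤N Fin.zero) (‖‖∞-lub (λ i → ∣v∣≤N (Fin.suc i)))

∣coordinate∣≤‖‖∞ : ∀ {k} (v : Fin k → ℤ) i → ∣ v i ∣ ≤ ‖ v ‖∞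
∣coordinate∣≤‖‖∞ v Fin.zero    = ℕ.m≤m⊔n _ _
∣coordinate∣≤‖‖∞ v (Fin.suc i) = ℕ.≤-trans (∣coordinate∣≤‖‖∞ (λ i → v (Fin.suc i)) i) (ℕ.m≤n⊔m _ _)

nonneg-∣∣≤⇒≤ : ∀ {i N} → + 0 ℤ.≤ i → ∣ i ∣ ≤ N → i ℤ.≤ + N
nonneg-∣∣≤⇒≤ (+≤+ _) = +≤+

nonneg-≤⇒∣∣≤ : ∀ {i N} → + 0 ℤ.≤ i → i ℤ.≤ + N → ∣ i ∣ ≤ N
nonneg-≤⇒∣∣≤ (+≤+ _) = ℤ.drop‿+≤+

pos-*-nonneg : ∀ w {i} → + 0 ℤ.≤ i → + 0 ℤ.≤ + w ℤ.* i
pos-*-nonneg w {+ i} _ = subst (+ 0 ℤ.≤_) (ℤ.pos-* w i) (+≤+ z≤n)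

-- The right-hand side is what voter j contributes to the margin after ranking
-- c_i first and c_m last.
margin-minus-wΔ : ∀ (w am ai first last : ℕ) →
  (+ (w ℕ.* am) ℤ.- + (w ℕ.* ai)) ℤ.- + w ℤ.* (((+ first ℤ.- + ai) ℤ.+ + am) ℤ.- + last)
  ≡ + (w ℕ.* last) ℤ.- + (w ℕ.* first)
margin-minus-wΔ w am ai first last
  rewrite ℤ.pos-* w am | ℤ.pos-* w ai | ℤ.pos-* w last | ℤ.pos-* w first =
  rearrange (+ w) (+ am) (+ ai) (+ first) (+ last)
  where
  rearrange : ∀ w am ai first last →
    (w ℤ.* am ℤ.- w ℤ.* ai) ℤ.- w ℤ.* (((first ℤ.- ai) ℤ.+ am) ℤ.- last)
    ≡ w ℤ.* last ℤ.- w ℤ.* first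
  rearrange = solve-∀

promote : ∀ {k} → Fin k → Permutation′ (suc k)
promote i = transpose Fin.zero (inject₁ i)

pos-promote-self : ∀ {k} (i : Fin k) → pos (promote i) (inject₁ i) ≡ Fin.zero
pos-promote-self i with inject₁ i Fin.≟ inject₁ i
... | yes _  = refl
... | no i≢i = ⊥-elim (i≢i refl)

pos-promote-last : ∀ {k} (i : Fin k) → pos (promote i) (fromℕ k) ≡ fromℕ k
pos-promote-last {suc k} i with fromℕ (suc k) Fin.≟ inject₁ i
... | yes m≡i = ⊥-elim (Fin.fromℕ≢inject₁ m≡i)
... | no _    = refl

module Election {k n : ℕ} (α : Fin (suc k) → ℕ) (w : Fin n → ℕ)
    (τ : Fin n → Permutation′ (suc k))
    (α-antitone : ∀ (a b : Fin (suc k)) → a Fin.≤ b → α b ≤ α a) where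

  cₘ : Fin (suc k)
  cₘ = fromℕ k

  Δ-nonneg : ∀ i j → + 0 ℤ.≤ Δ α τ i j
  Δ-nonneg i j = subst (+ 0 ℤ.≤_)
    (sym (ℤ.+-assoc (+ α Fin.zero ℤ.- + α (pos (τ j) (inject₁ i))) (+ α (pos (τ j) cₘ)) _))
    (ℤ.+-mono-≤ (ℤ.i≤j⇒0≤j-i (+≤+ (α-antitone Fin.zero _ z≤n)))
                (ℤ.i≤j⇒0≤j-i (+≤+ (α-antitone _ cₘ (Fin.≤fromℕ _)))))

  bribeGain : Subset n → Fin k → Fin n → ℤ
  bribeGain VB i j = if does (j ∈? VB) then + w j ℤ.* Δ α τ i j else + 0

  minmaxVector : Subset n → Fin k → ℤ
  minmaxVector VB i = + Λ α w τ (inject₁ i) ℤ.+ sumℤ (bribeGain VB i)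

  minmaxVector-nonneg : ∀ VB i → + 0 ℤ.≤ minmaxVector VB i
  minmaxVector-nonneg VB i = ℤ.+-mono-≤ (+≤+ z≤n) (sumℤ-nonneg gain-nonneg)
    where
    gain-nonneg : ∀ j → + 0 ℤ.≤ bribeGain VB i j
    gain-nonneg j with does (j ∈? VB)
    ... | true  = pos-*-nonneg (w j) (Δ-nonneg i j)
    ... | false = ℤ.≤-refl

  contribution : (Fin n → Permutation′ (suc k)) → Fin (suc k) → Fin n → ℕ
  contribution ρ c j = w j ℕ.* α (pos (ρ j) c)

  margin : (Fin n → Permutation′ (suc k)) → Fin k → Fin n → ℤ
  margin ρ i j = + contribution ρ cₘ j ℤ.- + contribution ρ (inject₁ i) j

  score-margin : ∀ ρ i →
    + score α w ρ cₘ ℤ.- + score α w ρ (inject₁ i) ≡ sumℤ (margin ρ i)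
  score-margin ρ i =
    trans (cong₂ ℤ._-_ (pos-sumℕ (contribution ρ cₘ)) (pos-sumℕ (contribution ρ (inject₁ i))))
          (sym (sumℤ-minus (λ j → + contribution ρ cₘ j) (λ j → + contribution ρ (inject₁ i) j)))

  worstMargin : Subset n → Fin k → Fin n → ℤ
  worstMargin VB i j =
    if does (j ∈? VB) then + (w j ℕ.* α cₘ) ℤ.- + (w j ℕ.* α Fin.zero) else margin τ i j

  margin-minus-bribeGain : ∀ VB i j → margin τ i j ℤ.- bribeGain VB i j ≡ worstMargin VB i j
  margin-minus-bribeGain VB i j with does (j ∈? VB)
  ... | true  = margin-minus-wΔ (w j) _ _ (α Fin.zero) (α cₘ)
  ... | false = ℤ.+-identityʳ _

  Λ-minus-minmaxVector : ∀ VB i → + Λ α w τ cₘ ℤ.- minmaxVector VB i ≡ sumℤ (worstMargin VB i)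
  Λ-minus-minmaxVector VB i = begin
      + Λ α w τ cₘ ℤ.- (+ Λ α w τ (inject₁ i) ℤ.+ sumℤ (bribeGain VB i))
    ≡⟨ regroup (+ Λ α w τ cₘ) (+ Λ α w τ (inject₁ i)) _ ⟩
      (+ Λ α w τ cₘ ℤ.- + Λ α w τ (inject₁ i)) ℤ.- sumℤ (bribeGain VB i)
    ≡⟨ cong (ℤ._- sumℤ (bribeGain VB i)) (score-margin τ i) ⟩
      sumℤ (margin τ i) ℤ.- sumℤ (bribeGain VB i)
    ≡⟨ sym (sumℤ-minus (margin τ i) (bribeGain VB i)) ⟩
      sumℤ (λ j → margin τ i j ℤ.- bribeGain VB i j)
    ≡⟨ sumℤ-cong (margin-minus-bribeGain VB i) ⟩
      sumℤ (worstMargin VB i) ∎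
    where
    open ≡-Reasoning
    regroup : ∀ a b c → a ℤ.- (b ℤ.+ c) ≡ (a ℤ.- b) ℤ.- c
    regroup = solve-∀

  worstMargin≤margin : ∀ VB σ i j → worstMargin VB i j ℤ.≤ margin (bribed τ VB σ) i j
  worstMargin≤margin VB σ i j with does (j ∈? VB)
  ... | true  = ℤ.+-mono-≤ (+≤+ (ℕ.*-monoʳ-≤ (w j) (α-antitone _ cₘ (Fin.≤fromℕ _))))
                           (ℤ.neg-mono-≤ (+≤+ (ℕ.*-monoʳ-≤ (w j) (α-antitone Fin.zero _ z≤n))))
  ... | false = ℤ.≤-refl

  margin-promote : ∀ VB i j → margin (bribed τ VB (λ _ → promote i)) i j ≡ worstMargin VB i j
  margin-promote VB i j with does (j ∈? VB)
  ... | true rewrite pos-promote-self i | pos-promote-last i = refl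
  ... | false = refl

  minmax-safe⇒bribe-safe : ∀ VB σ i → ‖ minmaxVector VB ‖∞ ≤ Λ α w τ cₘ →
    score α w (bribed τ VB σ) (inject₁ i) ≤ score α w (bribed τ VB σ) cₘ
  minmax-safe⇒bribe-safe VB σ i ‖v‖≤Λ = ℤ.drop‿+≤+ (ℤ.0≤i-j⇒j≤i (begin
      + 0
    ≤⟨ ℤ.i≤j⇒0≤j-i (nonneg-∣∣≤⇒≤ (minmaxVector-nonneg VB i)
                      (ℕ.≤-trans (∣coordinate∣≤‖‖∞ (minmaxVector VB) i) ‖v‖≤Λ)) ⟩
      + Λ α w τ cₘ ℤ.- minmaxVector VB i
    ≡⟨ Λ-minus-minmaxVector VB i ⟩
      sumℤ (worstMargin VB i)
    ≤⟨ sumℤ-mono-≤ (worstMargin≤margin VB σ i) ⟩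
      sumℤ (margin (bribed τ VB σ) i)
    ≡⟨ sym (score-margin (bribed τ VB σ) i) ⟩
      + score α w (bribed τ VB σ) cₘ ℤ.- + score α w (bribed τ VB σ) (inject₁ i) ∎))
    where open ℤ.≤-Reasoning

  bribe-safe⇒minmax-safe : ∀ VB →
    (∀ σ i → score α w (bribed τ VB σ) (inject₁ i) ≤ score α w (bribed τ VB σ) cₘ) →
    ‖ minmaxVector VB ‖∞ ≤ Λ α w τ cₘ
  bribe-safe⇒minmax-safe VB safe =
    ‖‖∞-lub λ i → nonneg-≤⇒∣∣≤ (minmaxVector-nonneg VB i) (ℤ.0≤i-j⇒j≤i (0≤Λ-minmaxVector i))
    where
    open ℤ.≤-Reasoning
    0≤Λ-minmaxVector : ∀ i → + 0 ℤ.≤ + Λ α w τ cₘ ℤ.- minmaxVector VB i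
    0≤Λ-minmaxVector i = begin
        + 0
      ≤⟨ ℤ.i≤j⇒0≤j-i (+≤+ (safe (λ _ → promote i) i)) ⟩
        + score α w ρ cₘ ℤ.- + score α w ρ (inject₁ i)
      ≡⟨ score-margin ρ i ⟩
        sumℤ (margin ρ i)
      ≡⟨ sumℤ-cong (margin-promote VB i) ⟩
        sumℤ (worstMargin VB i)
      ≡⟨ sym (Λ-minus-minmaxVector VB i) ⟩
        + Λ α w τ cₘ ℤ.- minmaxVector VB i ∎
      where
      ρ : Fin n → Permutation′ (suc k)
      ρ = bribed τ VB (λ _ → promote i)

lemma4 : (k n : ℕ) (α : Fin (suc k) → ℕ) (w : Fin n → ℕ)
    (τ : Fin n → Permutation′ (suc k)) (pa pb : Fin n → ℕ) (F B : ℕ)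
    → (∀ (a b : Fin (suc k)) → a Fin.≤ b → α b ≤ α a)
    → (∀ j → 0 < w j)
    → (∀ (i : Fin k) → Λ α w τ (inject₁ i) ≤ Λ α w τ (fromℕ k))
    → (ProtectionYes α w τ pa pb F B → MinmaxYes α w τ pa pb F B)
    × (MinmaxYes α w τ pa pb F B → ProtectionYes α w τ pa pb F B)
lemma4 k n α w τ pa pb F B α-antitone _ _ =
  (λ { (VF , VF-cost , safe) → VF , VF-cost , λ VB VB⊆∁VF VB-cost →
         bribe-safe⇒minmax-safe VB (safe VB VB⊆∁VF VB-cost) })
  ,
  (λ { (VF , VF-cost , safe) → VF , VF-cost , λ VB VB⊆∁VF VB-cost σ i →
         minmax-safe⇒bribe-safe VB σ i (safe VB VB⊆∁VF VB-cost) })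
  where open Election α w τ α-antitone
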